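{- For every strong fixed-point context $\Upsilon_{A,\overline{c_0}}$ with $\overline{c_0}\subseteq\overline{c}$, every permutation $\pi$ and every nominal term $t$: $\mathsf{N}\,\overline{c}.\,\Upsilon_{A,\overline{c_0}}\vdash \pi\curlywedge t$ is derivable if and only if $\mathsf{N}\,\overline{c}.\,\Upsilon_{A,\overline{c_0}}\vdash \pi\cdot t\approx_\alpha t$ is derivable.
   Context: Nominal terms are built from atoms $a$, suspensions $\pi\cdot X$ (with $\pi$ a finite permutation of atoms and $X$ a variable), abstractions $[a]t$ and applications $\mathtt{f}(t_1,\dots,t_n)$. A fixed-point constraint $\pi\curlywedge t$ means "the permutation $\pi$ fixes $t$". $\mathsf{N}$ denotes Pitts' "new" quantifier (quantification over fresh atoms). A strong fixed-point context $\Upsilon_{A,C}$ is a finite set of primitive constraints of the form $\mathsf{N}c.(a\ c)\curlywedge X$ with $a\in A$, $c\in C$, for disjoint sets of atoms $A$ and $C$ (the $\mathsf{N}$-quantifiers are moved to the front). A strong fixed-point judgement has the form $\mathsf{N}\,\overline{c}.(\Upsilon_{A,\overline{c_0}}\vdash\pi\curlywedge t)$ and a strong $\alpha$-equality judgement has the form $\mathsf{N}\,\overline{c}.(\Upsilon_{A,\overline{c_0}}\vdash s\approx_\alpha t)$, where $\overline{c}$ is a list of distinct atoms and $\overline{c_0}\subseteq\overline{c}$. Derivability is with respect to the following rules (here $\mathrm{dom}(\mathrm{perm}(\Upsilon|_X))=\{a\mid (a\ c)\curlywedge X\in\Upsilon\}$ and $\pi^{\rho}=\rho\circ\pi\circ\rho^{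 -1}$): $\pi\curlywedge a$ if $\pi(a)=a$; $\pi\curlywedge\rho\cdot X$ if $\mathrm{dom}(\pi^{\rho^{ -1}})\setminus\overline{c}\subseteq\mathrm{dom}(\mathrm{perm}(\Upsilon|_X))$; $\pi\curlywedge\mathtt{f}(t_1,\dots,t_n)$ from $\pi\curlywedge t_i$ for all $i$; $\pi\curlywedge[a]t$ from $\mathsf{N}\,\overline{c},c_1.\,\Upsilon\vdash\pi\curlywedge(a\ c_1)\cdot t$; $a\approx_\alpha a$; $\pi\cdot X\approx_\alpha\rho\cdot X$ if $\mathrm{dom}(\rho^{ -1}\circ\pi)\setminus\overline{c}\subseteq\mathrm{dom}(\mathrm{perm}(\Upsilon|_X))$; congruence for $\mathtt{f}$ and for $[a]$; and $[a]s\approx_\alpha[b]t$ from $s\approx_\alpha(a\ b)\cdot t$ and $\mathsf{N}\,\overline{c},c_1.\,\Upsilon\vdash(a\ c_1)\curlywedge t$. -}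

module Defs where

open import Data.Nat using (ℕ; _≟_)
open import Data.Bool using (if_then_else_)
open import Data.List using (List; []; _∷_; _++_; reverse; [_])
open import Data.Product using (_×_; _,_; ∃)
open import Relation.Nullary using (¬_)
open import Relation.Nullary.Decidable using (⌊_⌋)
open import Relation.Binary.PropositionalEquality using (_≡_; _≢_)
open import Data.List.Membership.Propositional using (_∈_; _∉_)
open import Data.List.Relation.Unary.All using (All)
open import Data.List.Relation.Binary.Pointwise using (Pointwise)

-- Atoms, variables and function symbols are named by natural numbers
-- (a countably infinite supply of atoms with decidable equality).
Atom : Set
Atom = ℕ

Var : Set
Var = ℕ

FunSym : Set
FunSym = ℕ

swapAtom : Atom × Atom → Atom → Atom
swapAtom (a , b) c = if ⌊ c ≟ a ⌋ then b else (if ⌊ c ≟ b ⌋ then a else c)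

-- A finite permutation, represented as a list of swappings
-- (s₁ ∷ s₂ ∷ … ∷ sₙ) denoting s₁ ∘ s₂ ∘ … ∘ sₙ.
-- Every finite permutation of atoms is of this form.
Perm : Set
Perm = List (Atom × Atom)

apply : Perm → Atom → Atom
apply [] c = c
apply (s ∷ π) c = swapAtom s (apply π c)

_∘ₚ_ : Perm → Perm → Perm
π ∘ₚ ρ = π ++ ρ

_⁻¹ₚ : Perm → Perm
π ⁻¹ₚ = reverse π

swp : Atom → Atom → Perm
swp a c = [ (a , c) ]

data Term : Set where
  atom : Atom → Term
  susp : Perm → Var → Term
  abs  : Atom → Term → Term
  app  : FunSym → List Term → Term

mutual
  act : Perm → Term → Term
  act π (atom a) = atom (apply π a)
  act π (susp ρ X) = susp (π ∘ₚ ρ) X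
  act π (abs a t) = abs (apply π a) (act π t)
  act π (app f ts) = app f (actL π ts)

  actL : Perm → List Term → List Term
  actL π [] = []
  actL π (t ∷ ts) = act π t ∷ actL π ts

-- A primitive constraint  Nc.(a c) ⋏ X  is recorded as the triple (a , c , X).
Constraint : Set
Constraint = Atom × Atom × Var

Ctx : Set
Ctx = List Constraint

StrongCtx : List Atom → List Atom → Ctx → Set
StrongCtx A C Υ =
  All (λ { (a , c , X) → (a ∈ A) × (c ∈ C) }) Υ × (∀ x → x ∈ A → x ∉ C)

-- a ∈ dom(perm(Υ|_X))  iff  (a c)⋏X ∈ Υ for some c
InDom : Ctx → Var → Atom → Set
InDom Υ X a = ∃ λ c → (a , c , X) ∈ Υ

-- dom(σ) \ c̄ ⊆ dom(perm(Υ|_X))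
DomCond : Ctx → List Atom → Perm → Var → Set
DomCond Υ cs σ X = ∀ b → apply σ b ≢ b → b ∉ cs → InDom Υ X b

-- The N-quantified new atom c₁ in the abstraction rule is rendered by
-- cofinite quantification (for all c₁ outside some finite list L).
data FixD (Υ : Ctx) (cs : List Atom) (π : Perm) : Term → Set where
  fx-atom : ∀ {a} → apply π a ≡ a → FixD Υ cs π (atom a)
  fx-susp : ∀ {ρ X} → DomCond Υ cs ((ρ ⁻¹ₚ) ∘ₚ (π ∘ₚ ρ)) X
          → FixD Υ cs π (susp ρ X)
  fx-app  : ∀ {f ts} → All (FixD Υ cs π) ts → FixD Υ cs π (app f ts)
  fx-abs  : ∀ {a t} (L : List Atom)
          → (∀ c₁ → c₁ ∉ L → FixD Υ (cs ++ [ c₁ ]) π (act (swp a c₁) t))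
          → FixD Υ cs π (abs a t)

data AlphaD (Υ : Ctx) (cs : List Atom) : Term → Term → Set where
  α-atom  : ∀ {a} → AlphaD Υ cs (atom a) (atom a)
  α-susp  : ∀ {π ρ X} → DomCond Υ cs ((ρ ⁻¹ₚ) ∘ₚ π) X
          → AlphaD Υ cs (susp π X) (susp ρ X)
  α-app   : ∀ {f ss ts} → Pointwise (AlphaD Υ cs) ss ts
          → AlphaD Υ cs (app f ss) (app f ts)
  α-absEq : ∀ {a s t} → AlphaD Υ cs s t → AlphaD Υ cs (abs a s) (abs a t)
  α-ab    : ∀ {a b s t} → AlphaD Υ cs s (act (swp a b) t)
          → (L : List Atom)
          → (∀ c₁ → c₁ ∉ L → FixD Υ (cs ++ [ c₁ ]) (swp a c₁) t)
          → AlphaD Υ cs (abs a s) (abs b t)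

{-# OPTIONS --safe #-}
-- For atoms, suspensions and function symbols the fixed-point rules and the α-equality rules
-- impose literally the same side conditions, so only an abstraction [a]t needs an argument.
-- By equivariance, π ⋏ (a c)·t for a new atom c amounts to (a c)π(a c) ⋏ t.  If π a = a this
-- is just π ⋏ t, since π also fixes the new c, and c can be dropped from c̄ as it does not occur
-- in t.  If b = π a ≠ a, the α-rule for [b](π·t) ≈α [a]t asks instead for (b a)π ⋏ t and, for
-- new c, (b c) ⋏ t.  The two sets of conditions are interderivable because
-- (a c)π(a c) = (b c)(b a)π whenever π fixes c, because fixed-point judgements are closed under
-- composition, and because σ ⋏ t with σ b ≠ b yields (b c) ⋏ t for every c ∈ c̄ not in t;
-- here σ = (a c)π(a c) indeed moves b.
module Submission where

open import Defs
open import Data.Empty using (⊥-elim)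
open import Data.List using (List; []; _∷_; _++_; [_])
open import Data.List.Extrema.Nat using (max; xs≤max)
open import Data.List.Membership.Propositional using (_∈_; _∉_)
open import Data.List.Membership.Propositional.Properties using (∈-++⁺ˡ; ∈-++⁺ʳ)
open import Data.List.Properties using (++-assoc; unfold-reverse; reverse-++)
open import Data.List.Relation.Binary.Permutation.Propositional using (↭-sym)
open import Data.List.Relation.Binary.Permutation.Propositional.Properties using (∈-resp-↭; ∷↭∷ʳ)
open import Data.List.Relation.Binary.Pointwise using (Pointwise; []; _∷_)
open import Data.List.Relation.Binary.Subset.Propositional using (_⊆_)
open import Data.List.Relation.Binary.Subset.Propositional.Properties using (++⁺ˡ; xs⊆xs++ys)
open import Data.List.Relation.Unary.All as All using (All; []; _∷_)
open import Data.List.Relation.Unary.Any using (here; there)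
open import Data.List.Relation.Unary.Unique.Propositional using (Unique)
open import Data.Nat using (suc; _≟_)
open import Data.Nat.Properties using (<-irrefl)
open import Data.Product using (_,_)
open import Function using (_∘_)
open import Function.Bundles using (_⇔_; mk⇔)
open import Level using (0ℓ)
open import Relation.Binary.Bundles using (Setoid)
import Relation.Binary.Reasoning.Setoid
open import Relation.Binary.PropositionalEquality
  using (_≡_; _≢_; _≗_; refl; sym; trans; cong; cong₂; subst; module ≡-Reasoning)
open import Relation.Nullary using (yes; no)

-- Swappings and permutations

data SwapView (a b x : Atom) : Set where
  is-first  : x ≡ a → SwapView a b x
  is-second : x ≢ a → x ≡ b → SwapView a b x
  is-other  : x ≢ a → x ≢ b → SwapView a b x

swapView : ∀ a b x → SwapView a b x
swapView a b x with x ≟ a | x ≟ b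
... | yes x≡a | _       = is-first x≡a
... | no x≢a  | yes x≡b = is-second x≢a x≡b
... | no x≢a  | no x≢b  = is-other x≢a x≢b

swap-first : ∀ a b → swapAtom (a , b) a ≡ b
swap-first a b with a ≟ a
... | yes _   = refl
... | no a≢a = ⊥-elim (a≢a refl)

swap-second : ∀ a b → swapAtom (a , b) b ≡ a
swap-second a b with b ≟ a
... | yes b≡a = b≡a
... | no _ with b ≟ b
...   | yes _   = refl
...   | no b≢b = ⊥-elim (b≢b refl)

swap-other : ∀ {a b x} → x ≢ a → x ≢ b → swapAtom (a , b) x ≡ x
swap-other {a} {b} {x} x≢a x≢b with x ≟ a
... | yes x≡a = ⊥-elim (x≢a x≡a)
... | no _ with x ≟ b
...   | yes x≡b = ⊥-elim (x≢b x≡b)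
...   | no _    = refl

swap-involutive : ∀ s x → swapAtom s (swapAtom s x) ≡ x
swap-involutive (a , b) x with swapView a b x
... | is-first refl       = trans (cong (swapAtom (a , b)) (swap-first a b)) (swap-second a b)
... | is-second _ refl    = trans (cong (swapAtom (a , b)) (swap-second a b)) (swap-first a b)
... | is-other x≢a x≢b =
  trans (cong (swapAtom (a , b)) (swap-other x≢a x≢b)) (swap-other x≢a x≢b)

swap-self : ∀ a x → swapAtom (a , a) x ≡ x
swap-self a x with swapView a a x
... | is-first refl       = swap-first a a
... | is-second _ refl    = swap-second a a
... | is-other x≢a x≢a′ = swap-other x≢a x≢a′

apply-∘ : ∀ π ρ x → apply (π ∘ₚ ρ) x ≡ apply π (apply ρ x)
apply-∘ []      ρ x = refl
apply-∘ (s ∷ π) ρ x = cong (swapAtom s) (apply-∘ π ρ x)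

apply-⁻¹-∷ : ∀ s π x → apply ((s ∷ π) ⁻¹ₚ) x ≡ apply (π ⁻¹ₚ) (swapAtom s x)
apply-⁻¹-∷ s π x =
  trans (cong (λ σ → apply σ x) (unfold-reverse s π)) (apply-∘ (π ⁻¹ₚ) [ s ] x)

apply-⁻¹-∘ : ∀ π ρ x → apply ((π ∘ₚ ρ) ⁻¹ₚ) x ≡ apply (ρ ⁻¹ₚ) (apply (π ⁻¹ₚ) x)
apply-⁻¹-∘ π ρ x = trans (cong (λ σ → apply σ x) (reverse-++ π ρ)) (apply-∘ (ρ ⁻¹ₚ) (π ⁻¹ₚ) x)

apply-⁻¹ˡ : ∀ π x → apply (π ⁻¹ₚ) (apply π x) ≡ x
apply-⁻¹ˡ []      x = refl
apply-⁻¹ˡ (s ∷ π) x = begin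
  apply ((s ∷ π) ⁻¹ₚ) (swapAtom s (apply π x))       ≡⟨ apply-⁻¹-∷ s π _ ⟩
  apply (π ⁻¹ₚ) (swapAtom s (swapAtom s (apply π x))) ≡⟨ cong (apply (π ⁻¹ₚ)) (swap-involutive s _) ⟩
  apply (π ⁻¹ₚ) (apply π x)                            ≡⟨ apply-⁻¹ˡ π x ⟩
  x                                                    ∎
  where open ≡-Reasoning

apply-⁻¹ʳ : ∀ π x → apply π (apply (π ⁻¹ₚ) x) ≡ x
apply-⁻¹ʳ []      x = refl
apply-⁻¹ʳ (s ∷ π) x = begin
  swapAtom s (apply π (apply ((s ∷ π) ⁻¹ₚ) x))       ≡⟨ cong (swapAtom s ∘ apply π) (apply-⁻¹-∷ s π x) ⟩
  swapAtom s (apply π (apply (π ⁻¹ₚ) (swapAtom s x))) ≡⟨ cong (swapAtom s) (apply-⁻¹ʳ π _) ⟩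
  swapAtom s (swapAtom s x)                            ≡⟨ swap-involutive s x ⟩
  x                                                    ∎
  where open ≡-Reasoning

apply-injective : ∀ π {x y} → apply π x ≡ apply π y → x ≡ y
apply-injective π {x} {y} πx≡πy = begin
  x                          ≡⟨ apply-⁻¹ˡ π x ⟨
  apply (π ⁻¹ₚ) (apply π x) ≡⟨ cong (apply (π ⁻¹ₚ)) πx≡πy ⟩
  apply (π ⁻¹ₚ) (apply π y) ≡⟨ apply-⁻¹ˡ π y ⟩
  y                          ∎
  where open ≡-Reasoning

swap-equivariant : ∀ τ a b x →
  apply τ (swapAtom (a , b) x) ≡ swapAtom (apply τ a , apply τ b) (apply τ x)
swap-equivariant τ a b x with swapView a b x
... | is-first refl    =
  trans (cong (apply τ) (swap-first a b)) (sym (swap-first (apply τ a) (apply τ b)))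
... | is-second _ refl =
  trans (cong (apply τ) (swap-second a b)) (sym (swap-second (apply τ a) (apply τ b)))
... | is-other x≢a x≢b = trans (cong (apply τ) (swap-other x≢a x≢b))
  (sym (swap-other (x≢a ∘ apply-injective τ) (x≢b ∘ apply-injective τ)))

infix 4 _≈ₚ_
record _≈ₚ_ (π ρ : Perm) : Set where
  constructor mk≈ₚ
  field apply-≈ : apply π ≗ apply ρ
open _≈ₚ_ public

≈ₚ-setoid : Setoid 0ℓ 0ℓ
≈ₚ-setoid = record
  { Carrier       = Perm
  ; _≈_           = _≈ₚ_
  ; isEquivalence = record
    { refl  = mk≈ₚ λ _ → refl
    ; sym   = λ π≈ρ → mk≈ₚ λ x → sym (apply-≈ π≈ρ x)
    ; trans = λ π≈ρ ρ≈σ → mk≈ₚ λ x → trans (apply-≈ π≈ρ x) (apply-≈ ρ≈σ x)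
    }
  }

module ≈ₚ-Reasoning = Relation.Binary.Reasoning.Setoid ≈ₚ-setoid
open Setoid ≈ₚ-setoid public using () renaming (refl to ≈ₚ-refl; sym to ≈ₚ-sym; trans to ≈ₚ-trans)

∘-cong : ∀ {π π′ ρ ρ′} → π ≈ₚ π′ → ρ ≈ₚ ρ′ → π ∘ₚ ρ ≈ₚ π′ ∘ₚ ρ′
∘-cong {π} {π′} {ρ} {ρ′} π≈π′ ρ≈ρ′ = mk≈ₚ λ x → begin
  apply (π ∘ₚ ρ) x       ≡⟨ apply-∘ π ρ x ⟩
  apply π (apply ρ x)    ≡⟨ cong (apply π) (apply-≈ ρ≈ρ′ x) ⟩
  apply π (apply ρ′ x)   ≡⟨ apply-≈ π≈π′ _ ⟩
  apply π′ (apply ρ′ x)  ≡⟨ apply-∘ π′ ρ′ x ⟨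
  apply (π′ ∘ₚ ρ′) x     ∎
  where open ≡-Reasoning

∘-congˡ : ∀ π {ρ ρ′} → ρ ≈ₚ ρ′ → π ∘ₚ ρ ≈ₚ π ∘ₚ ρ′
∘-congˡ π = ∘-cong (≈ₚ-refl {π})

∘-congʳ : ∀ σ {π π′} → π ≈ₚ π′ → π ∘ₚ σ ≈ₚ π′ ∘ₚ σ
∘-congʳ σ π≈π′ = ∘-cong π≈π′ (≈ₚ-refl {σ})

⁻¹-cong : ∀ {π ρ} → π ≈ₚ ρ → π ⁻¹ₚ ≈ₚ ρ ⁻¹ₚ
⁻¹-cong {π} {ρ} π≈ρ = mk≈ₚ λ x → begin
  apply (π ⁻¹ₚ) x                                ≡⟨ apply-⁻¹ˡ ρ _ ⟨
  apply (ρ ⁻¹ₚ) (apply ρ (apply (π ⁻¹ₚ) x))     ≡⟨ cong (apply (ρ ⁻¹ₚ)) (apply-≈ π≈ρ _) ⟨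
  apply (ρ ⁻¹ₚ) (apply π (apply (π ⁻¹ₚ) x))     ≡⟨ cong (apply (ρ ⁻¹ₚ)) (apply-⁻¹ʳ π x) ⟩
  apply (ρ ⁻¹ₚ) x                                ∎
  where open ≡-Reasoning

∘-swap : ∀ τ {a b a′ b′} → apply τ a ≡ a′ → apply τ b ≡ b′ → τ ∘ₚ swp a b ≈ₚ swp a′ b′ ∘ₚ τ
∘-swap τ {a} {b} refl refl = mk≈ₚ λ x → trans (apply-∘ τ (swp a b) x) (swap-equivariant τ a b x)

swp-∘-swp : ∀ a b π → swp a b ∘ₚ (swp a b ∘ₚ π) ≈ₚ π
swp-∘-swp a b π = mk≈ₚ λ x → swap-involutive (a , b) (apply π x)

conj : Perm → Perm → Perm
conj τ π = τ ∘ₚ (π ∘ₚ (τ ⁻¹ₚ))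

apply-conj-apply : ∀ τ π x → apply (conj τ π) (apply τ x) ≡ apply τ (apply π x)
apply-conj-apply τ π x = begin
  apply (τ ∘ₚ (π ∘ₚ (τ ⁻¹ₚ))) (apply τ x)        ≡⟨ apply-∘ τ _ _ ⟩
  apply τ (apply (π ∘ₚ (τ ⁻¹ₚ)) (apply τ x))     ≡⟨ cong (apply τ) (apply-∘ π _ _) ⟩
  apply τ (apply π (apply (τ ⁻¹ₚ) (apply τ x)))  ≡⟨ cong (apply τ ∘ apply π) (apply-⁻¹ˡ τ x) ⟩
  apply τ (apply π x)                             ∎
  where open ≡-Reasoning

conj-swp : ∀ τ {a b a′ b′} → apply τ a ≡ a′ → apply τ b ≡ b′ → conj τ (swp a b) ≈ₚ swp a′ b′
conj-swp τ {a} {b} refl refl = mk≈ₚ λ x → begin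
  apply (τ ∘ₚ (swp a b ∘ₚ (τ ⁻¹ₚ))) x                         ≡⟨ apply-∘ τ _ x ⟩
  apply τ (swapAtom (a , b) (apply (τ ⁻¹ₚ) x))                ≡⟨ swap-equivariant τ a b _ ⟩
  swapAtom (apply τ a , apply τ b) (apply τ (apply (τ ⁻¹ₚ) x)) ≡⟨ cong (swapAtom _) (apply-⁻¹ʳ τ x) ⟩
  swapAtom (apply τ a , apply τ b) x                           ∎
  where open ≡-Reasoning

apply-conj-swp : ∀ a b π x → apply (conj (swp a b) π) x ≡ swapAtom (a , b) (apply π (swapAtom (a , b) x))
apply-conj-swp a b π x = cong (swapAtom (a , b)) (apply-∘ π (swp a b) x)

conj-swp-involutive : ∀ a b π → conj (swp a b) (conj (swp a b) π) ≈ₚ π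
conj-swp-involutive a b π = mk≈ₚ λ x → begin
  apply (conj (swp a b) (conj (swp a b) π)) x       ≡⟨ apply-conj-swp a b (conj (swp a b) π) x ⟩
  swapAtom (a , b) (apply (conj (swp a b) π) (swapAtom (a , b) x))
    ≡⟨ cong (swapAtom (a , b)) (apply-conj-swp a b π _) ⟩
  swapAtom (a , b) (swapAtom (a , b) (apply π (swapAtom (a , b) (swapAtom (a , b) x))))
    ≡⟨ swap-involutive (a , b) _ ⟩
  apply π (swapAtom (a , b) (swapAtom (a , b) x))   ≡⟨ cong (apply π) (swap-involutive (a , b) x) ⟩
  apply π x                                          ∎
  where open ≡-Reasoning

conj-swp-fixed : ∀ {a b π} → apply π a ≡ a → apply π b ≡ b → conj (swp a b) π ≈ₚ π
conj-swp-fixed {a} {b} {π} πa≡a πb≡b = begin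
  swp a b ∘ₚ (π ∘ₚ swp a b)    ≈⟨ ∘-congˡ (swp a b) (∘-swap π πa≡a πb≡b) ⟩
  swp a b ∘ₚ (swp a b ∘ₚ π)    ≈⟨ swp-∘-swp a b π ⟩
  π                             ∎
  where open ≈ₚ-Reasoning

conj-swp-moved : ∀ {a c π} → apply π a ≢ a → apply π c ≡ c → c ≢ a →
  conj (swp a c) π ≈ₚ swp (apply π a) c ∘ₚ (swp (apply π a) a ∘ₚ π)
conj-swp-moved {a} {c} {π} πa≢a πc≡c c≢a = begin
  swp a c ∘ₚ (π ∘ₚ swp a c)               ≈⟨ ∘-congˡ (swp a c) (∘-swap π refl πc≡c) ⟩
  (swp a c ∘ₚ swp b c) ∘ₚ π
    ≈⟨ ∘-congʳ π (∘-swap (swp a c) (swap-other πa≢a b≢c) (swap-second a c)) ⟩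
  (swp b a ∘ₚ swp a c) ∘ₚ π
    ≈⟨ ∘-congʳ π (∘-swap (swp b a) (swap-second b a) (swap-other c≢b c≢a)) ⟩
  swp b c ∘ₚ (swp b a ∘ₚ π)               ∎
  where
  open ≈ₚ-Reasoning
  b = apply π a
  b≢c : b ≢ c
  b≢c b≡c = c≢a (apply-injective π (trans πc≡c (sym b≡c)))
  c≢b : c ≢ b
  c≢b = b≢c ∘ sym

swp-∘-conj-swp : ∀ {a c π} → apply π a ≢ a → apply π c ≡ c → c ≢ a →
  swp (apply π a) c ∘ₚ conj (swp a c) π ≈ₚ swp (apply π a) a ∘ₚ π
swp-∘-conj-swp {a} {c} {π} πa≢a πc≡c c≢a =
  ≈ₚ-trans (∘-congˡ (swp b c) (conj-swp-moved πa≢a πc≡c c≢a)) (swp-∘-swp b c (swp b a ∘ₚ π))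
  where b = apply π a

conj-swp-moves : ∀ {a c π} → apply π a ≢ a → apply π c ≡ c → c ≢ a →
  apply (conj (swp a c) π) (apply π a) ≢ apply π a
conj-swp-moves {a} {c} {π} πa≢a πc≡c c≢a σπa≡πa = πa≢a (apply-injective π ππa≡πa)
  where
  πa≢c : apply π a ≢ c
  πa≢c πa≡c = c≢a (apply-injective π (trans πc≡c (sym πa≡c)))
  swap-πa : swapAtom (a , c) (apply π a) ≡ apply π a
  swap-πa = swap-other πa≢a πa≢c
  ππa≡πa : apply π (apply π a) ≡ apply π a
  ππa≡πa = begin
    apply π (apply π a)                                          ≡⟨ cong (apply π) swap-πa ⟨
    apply π (swapAtom (a , c) (apply π a))                       ≡⟨ swap-involutive (a , c) _ ⟨
    swapAtom (a , c) (swapAtom (a , c) (apply π (swapAtom (a , c) (apply π a))))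
      ≡⟨ cong (swapAtom (a , c)) (apply-conj-swp a c π (apply π a)) ⟨
    swapAtom (a , c) (apply (conj (swp a c) π) (apply π a))      ≡⟨ cong (swapAtom (a , c)) σπa≡πa ⟩
    swapAtom (a , c) (apply π a)                                 ≡⟨ swap-πa ⟩
    apply π a                                                    ∎
    where open ≡-Reasoning

perm-atoms : Perm → List Atom
perm-atoms []            = []
perm-atoms ((a , b) ∷ π) = a ∷ b ∷ perm-atoms π

apply-∉-atoms : ∀ π {x} → x ∉ perm-atoms π → apply π x ≡ x
apply-∉-atoms []            x∉ = refl
apply-∉-atoms ((a , b) ∷ π) x∉ =
  trans (cong (swapAtom (a , b)) (apply-∉-atoms π (x∉ ∘ there ∘ there)))
        (swap-other (x∉ ∘ here) (x∉ ∘ there ∘ here))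

fresh : List Atom → Atom
fresh L = suc (max 0 L)

fresh-∉ : ∀ L → fresh L ∉ L
fresh-∉ L fresh∈L = <-irrefl refl (All.lookup (xs≤max 0 L) fresh∈L)

-- Permutation action and freshness on terms

infix 4 _≈ₜ_
data _≈ₜ_ : Term → Term → Set where
  atom-≈ : ∀ {a} → atom a ≈ₜ atom a
  susp-≈ : ∀ {π ρ X} → π ≈ₚ ρ → susp π X ≈ₜ susp ρ X
  abs-≈  : ∀ {a s t} → s ≈ₜ t → abs a s ≈ₜ abs a t
  app-≈  : ∀ {f ss ts} → Pointwise _≈ₜ_ ss ts → app f ss ≈ₜ app f ts

mutual
  ≈ₜ-refl : ∀ t → t ≈ₜ t
  ≈ₜ-refl (atom a)   = atom-≈
  ≈ₜ-refl (susp π X) = susp-≈ ≈ₚ-refl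
  ≈ₜ-refl (abs a t)  = abs-≈ (≈ₜ-refl t)
  ≈ₜ-refl (app f ts) = app-≈ (≈ₜ-reflL ts)

  ≈ₜ-reflL : ∀ ts → Pointwise _≈ₜ_ ts ts
  ≈ₜ-reflL []       = []
  ≈ₜ-reflL (t ∷ ts) = ≈ₜ-refl t ∷ ≈ₜ-reflL ts

mutual
  act-cong : ∀ {π ρ s t} → π ≈ₚ ρ → s ≈ₜ t → act π s ≈ₜ act ρ t
  act-cong π≈ρ (atom-≈ {a}) = subst (λ b → atom _ ≈ₜ atom b) (apply-≈ π≈ρ a) atom-≈
  act-cong π≈ρ (susp-≈ σ≈τ)  = susp-≈ (∘-cong π≈ρ σ≈τ)
  act-cong π≈ρ (abs-≈ {a} s≈t) =
    subst (λ b → abs _ _ ≈ₜ abs b _) (apply-≈ π≈ρ a) (abs-≈ (act-cong π≈ρ s≈t))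
  act-cong π≈ρ (app-≈ ss≈ts) = app-≈ (act-congL π≈ρ ss≈ts)

  act-congL : ∀ {π ρ ss ts} → π ≈ₚ ρ → Pointwise _≈ₜ_ ss ts → Pointwise _≈ₜ_ (actL π ss) (actL ρ ts)
  act-congL π≈ρ []             = []
  act-congL π≈ρ (s≈t ∷ ss≈ts) = act-cong π≈ρ s≈t ∷ act-congL π≈ρ ss≈ts

mutual
  act-∘ : ∀ π ρ t → act π (act ρ t) ≡ act (π ∘ₚ ρ) t
  act-∘ π ρ (atom a)   = cong atom (sym (apply-∘ π ρ a))
  act-∘ π ρ (susp σ X) = cong (λ τ → susp τ X) (sym (++-assoc π ρ σ))
  act-∘ π ρ (abs a t)  = cong₂ abs (sym (apply-∘ π ρ a)) (act-∘ π ρ t)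
  act-∘ π ρ (app f ts) = cong (app f) (act-∘L π ρ ts)

  act-∘L : ∀ π ρ ts → actL π (actL ρ ts) ≡ actL (π ∘ₚ ρ) ts
  act-∘L π ρ []       = refl
  act-∘L π ρ (t ∷ ts) = cong₂ _∷_ (act-∘ π ρ t) (act-∘L π ρ ts)

mutual
  act-id : ∀ t → act [] t ≡ t
  act-id (atom a)   = refl
  act-id (susp π X) = refl
  act-id (abs a t)  = cong (abs a) (act-id t)
  act-id (app f ts) = cong (app f) (act-idL ts)

  act-idL : ∀ ts → actL [] ts ≡ ts
  act-idL []       = refl
  act-idL (t ∷ ts) = cong₂ _∷_ (act-id t) (act-idL ts)

act-act : ∀ {π ρ σ} t → π ∘ₚ ρ ≈ₚ σ → act π (act ρ t) ≈ₜ act σ t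
act-act {π} {ρ} {σ} t πρ≈σ = subst (_≈ₜ act σ t) (sym (act-∘ π ρ t)) (act-cong πρ≈σ (≈ₜ-refl t))

act-act-cancel : ∀ {π ρ} t → π ∘ₚ ρ ≈ₚ [] → act π (act ρ t) ≈ₜ t
act-act-cancel {π} {ρ} t πρ≈id = subst (act π (act ρ t) ≈ₜ_) (act-id t) (act-act t πρ≈id)

act²-cong : ∀ {π ρ π′ ρ′} t → π ∘ₚ ρ ≈ₚ π′ ∘ₚ ρ′ → act π (act ρ t) ≈ₜ act π′ (act ρ′ t)
act²-cong {π} {ρ} {π′} {ρ′} t e = subst (act π (act ρ t) ≈ₜ_) (sym (act-∘ π′ ρ′ t)) (act-act t e)

-- c does not occur in t; a suspension π · X counts as mentioning only the atoms moved by π.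
infix 4 _#_
data _#_ (c : Atom) : Term → Set where
  atom-# : ∀ {a} → c ≢ a → c # atom a
  susp-# : ∀ {π X} → apply π c ≡ c → c # susp π X
  abs-#  : ∀ {a t} → c ≢ a → c # t → c # abs a t
  app-#  : ∀ {f ts} → All (c #_) ts → c # app f ts

mutual
  term-atoms : Term → List Atom
  term-atoms (atom a)   = [ a ]
  term-atoms (susp π X) = perm-atoms π
  term-atoms (abs a t)  = a ∷ term-atoms t
  term-atoms (app f ts) = terms-atoms ts

  terms-atoms : List Term → List Atom
  terms-atoms []       = []
  terms-atoms (t ∷ ts) = term-atoms t ++ terms-atoms ts

mutual
  ∉-atoms⇒# : ∀ {c} t → c ∉ term-atoms t → c # t
  ∉-atoms⇒# (atom a)   c∉ = atom-# (c∉ ∘ here)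
  ∉-atoms⇒# (susp π X) c∉ = susp-# (apply-∉-atoms π c∉)
  ∉-atoms⇒# (abs a t)  c∉ = abs-# (c∉ ∘ here) (∉-atoms⇒# t (c∉ ∘ there))
  ∉-atoms⇒# (app f ts) c∉ = app-# (∉-atoms⇒#L ts c∉)

  ∉-atoms⇒#L : ∀ {c} ts → c ∉ terms-atoms ts → All (c #_) ts
  ∉-atoms⇒#L []       c∉ = []
  ∉-atoms⇒#L (t ∷ ts) c∉ =
    ∉-atoms⇒# t (c∉ ∘ ∈-++⁺ˡ) ∷ ∉-atoms⇒#L ts (c∉ ∘ ∈-++⁺ʳ (term-atoms t))

mutual
  #-act : ∀ {c} π {t} → apply π c ≡ c → c # t → c # act π t
  #-act π πc≡c (atom-# c≢a)     = atom-# (c≢a ∘ apply-injective π ∘ trans πc≡c)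
  #-act π πc≡c (susp-# {ρ} ρc≡c) =
    susp-# (trans (apply-∘ π ρ _) (trans (cong (apply π) ρc≡c) πc≡c))
  #-act π πc≡c (abs-# c≢a c#t)  = abs-# (c≢a ∘ apply-injective π ∘ trans πc≡c) (#-act π πc≡c c#t)
  #-act π πc≡c (app-# c#ts)     = app-# (#-actL π πc≡c c#ts)

  #-actL : ∀ {c} π {ts} → apply π c ≡ c → All (c #_) ts → All (c #_) (actL π ts)
  #-actL π πc≡c []             = []
  #-actL π πc≡c (c#t ∷ c#ts) = #-act π πc≡c c#t ∷ #-actL π πc≡c c#ts

-- Closure properties of the two judgements

apply-conj⁻¹ : ∀ ρ π b → apply ((ρ ⁻¹ₚ) ∘ₚ (π ∘ₚ ρ)) b ≡ apply (ρ ⁻¹ₚ) (apply π (apply ρ b))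
apply-conj⁻¹ ρ π b = trans (apply-∘ (ρ ⁻¹ₚ) (π ∘ₚ ρ) b) (cong (apply (ρ ⁻¹ₚ)) (apply-∘ π ρ b))

conj⁻¹-fixed⁻ : ∀ ρ π {b} → apply ((ρ ⁻¹ₚ) ∘ₚ (π ∘ₚ ρ)) b ≡ b → apply π (apply ρ b) ≡ apply ρ b
conj⁻¹-fixed⁻ ρ π {b} fixed = begin
  apply π (apply ρ b)                           ≡⟨ apply-⁻¹ʳ ρ _ ⟨
  apply ρ (apply (ρ ⁻¹ₚ) (apply π (apply ρ b))) ≡⟨ cong (apply ρ) (apply-conj⁻¹ ρ π b) ⟨
  apply ρ (apply ((ρ ⁻¹ₚ) ∘ₚ (π ∘ₚ ρ)) b)       ≡⟨ cong (apply ρ) fixed ⟩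
  apply ρ b                                     ∎
  where open ≡-Reasoning

conj⁻¹-fixed⁺ : ∀ ρ π {b} → apply π (apply ρ b) ≡ apply ρ b → apply ((ρ ⁻¹ₚ) ∘ₚ (π ∘ₚ ρ)) b ≡ b
conj⁻¹-fixed⁺ ρ π {b} fixed =
  trans (apply-conj⁻¹ ρ π b) (trans (cong (apply (ρ ⁻¹ₚ)) fixed) (apply-⁻¹ˡ ρ b))

conj⁻¹-equivariant : ∀ τ π ρ →
  ((τ ∘ₚ ρ) ⁻¹ₚ) ∘ₚ (conj τ π ∘ₚ (τ ∘ₚ ρ)) ≈ₚ (ρ ⁻¹ₚ) ∘ₚ (π ∘ₚ ρ)
conj⁻¹-equivariant τ π ρ = mk≈ₚ λ b → begin
  apply (((τ ∘ₚ ρ) ⁻¹ₚ) ∘ₚ (conj τ π ∘ₚ (τ ∘ₚ ρ))) b            ≡⟨ apply-conj⁻¹ (τ ∘ₚ ρ) (conj τ π) b ⟩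
  apply ((τ ∘ₚ ρ) ⁻¹ₚ) (apply (conj τ π) (apply (τ ∘ₚ ρ) b))
    ≡⟨ cong (apply ((τ ∘ₚ ρ) ⁻¹ₚ) ∘ apply (conj τ π)) (apply-∘ τ ρ b) ⟩
  apply ((τ ∘ₚ ρ) ⁻¹ₚ) (apply (conj τ π) (apply τ (apply ρ b)))
    ≡⟨ cong (apply ((τ ∘ₚ ρ) ⁻¹ₚ)) (apply-conj-apply τ π _) ⟩
  apply ((τ ∘ₚ ρ) ⁻¹ₚ) (apply τ (apply π (apply ρ b)))         ≡⟨ apply-⁻¹-∘ τ ρ _ ⟩
  apply (ρ ⁻¹ₚ) (apply (τ ⁻¹ₚ) (apply τ (apply π (apply ρ b)))) ≡⟨ cong (apply (ρ ⁻¹ₚ)) (apply-⁻¹ˡ τ _) ⟩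
  apply (ρ ⁻¹ₚ) (apply π (apply ρ b))                         ≡⟨ apply-conj⁻¹ ρ π b ⟨
  apply ((ρ ⁻¹ₚ) ∘ₚ (π ∘ₚ ρ)) b                              ∎
  where open ≡-Reasoning

⁻¹∘-equivariant : ∀ τ π ρ → ((τ ∘ₚ ρ) ⁻¹ₚ) ∘ₚ (τ ∘ₚ π) ≈ₚ (ρ ⁻¹ₚ) ∘ₚ π
⁻¹∘-equivariant τ π ρ = mk≈ₚ λ x → begin
  apply (((τ ∘ₚ ρ) ⁻¹ₚ) ∘ₚ (τ ∘ₚ π)) x              ≡⟨ apply-∘ ((τ ∘ₚ ρ) ⁻¹ₚ) _ x ⟩
  apply ((τ ∘ₚ ρ) ⁻¹ₚ) (apply (τ ∘ₚ π) x)           ≡⟨ cong (apply ((τ ∘ₚ ρ) ⁻¹ₚ)) (apply-∘ τ π x) ⟩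
  apply ((τ ∘ₚ ρ) ⁻¹ₚ) (apply τ (apply π x))        ≡⟨ apply-⁻¹-∘ τ ρ _ ⟩
  apply (ρ ⁻¹ₚ) (apply (τ ⁻¹ₚ) (apply τ (apply π x))) ≡⟨ cong (apply (ρ ⁻¹ₚ)) (apply-⁻¹ˡ τ _) ⟩
  apply (ρ ⁻¹ₚ) (apply π x)                          ≡⟨ apply-∘ (ρ ⁻¹ₚ) π x ⟨
  apply ((ρ ⁻¹ₚ) ∘ₚ π) x                             ∎
  where open ≡-Reasoning

module _ {Υ : Ctx} where

  DomCond-resp : ∀ {cs σ σ′ X} → σ ≈ₚ σ′ → DomCond Υ cs σ X → DomCond Υ cs σ′ X
  DomCond-resp σ≈σ′ dom b moved = dom b (moved ∘ trans (sym (apply-≈ σ≈σ′ b)))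

  DomCond-mono : ∀ {cs cs′ X} σ → (∀ {b} → apply σ b ≢ b → b ∉ cs′ → b ∉ cs) →
    DomCond Υ cs σ X → DomCond Υ cs′ σ X
  DomCond-mono σ shrink dom b moved b∉cs′ = dom b moved (shrink moved b∉cs′)

  mutual
    FixD-resp : ∀ {cs π ρ s t} → π ≈ₚ ρ → s ≈ₜ t → FixD Υ cs π s → FixD Υ cs ρ t
    FixD-resp π≈ρ atom-≈ (fx-atom {a} πa≡a) = fx-atom (trans (sym (apply-≈ π≈ρ a)) πa≡a)
    FixD-resp π≈ρ (susp-≈ σ≈σ′) (fx-susp dom) =
      fx-susp (DomCond-resp (∘-cong (⁻¹-cong σ≈σ′) (∘-cong π≈ρ σ≈σ′)) dom)
    FixD-resp π≈ρ (abs-≈ s≈t) (fx-abs L fix) =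
      fx-abs L λ c c∉L → FixD-resp π≈ρ (act-cong ≈ₚ-refl s≈t) (fix c c∉L)
    FixD-resp π≈ρ (app-≈ ss≈ts) (fx-app fixes) = fx-app (FixD-respL π≈ρ ss≈ts fixes)

    FixD-respL : ∀ {cs π ρ ss ts} → π ≈ₚ ρ → Pointwise _≈ₜ_ ss ts →
      All (FixD Υ cs π) ss → All (FixD Υ cs ρ) ts
    FixD-respL π≈ρ []             []             = []
    FixD-respL π≈ρ (s≈t ∷ ss≈ts) (fix ∷ fixes) = FixD-resp π≈ρ s≈t fix ∷ FixD-respL π≈ρ ss≈ts fixes

  mutual
    FixD-mono : ∀ {cs cs′ π t} → cs ⊆ cs′ → FixD Υ cs π t → FixD Υ cs′ π t
    FixD-mono cs⊆cs′ (fx-atom πa≡a)  = fx-atom πa≡a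
    FixD-mono {π = π} cs⊆cs′ (fx-susp {ρ} dom) =
      fx-susp (DomCond-mono ((ρ ⁻¹ₚ) ∘ₚ (π ∘ₚ ρ)) (λ _ b∉cs′ → b∉cs′ ∘ cs⊆cs′) dom)
    FixD-mono cs⊆cs′ (fx-abs L fix)  = fx-abs L λ c c∉L → FixD-mono (++⁺ˡ [ c ] cs⊆cs′) (fix c c∉L)
    FixD-mono cs⊆cs′ (fx-app fixes) = fx-app (FixD-monoL cs⊆cs′ fixes)

    FixD-monoL : ∀ {cs cs′ π ts} → cs ⊆ cs′ → All (FixD Υ cs π) ts → All (FixD Υ cs′ π) ts
    FixD-monoL cs⊆cs′ []             = []
    FixD-monoL cs⊆cs′ (fix ∷ fixes) = FixD-mono cs⊆cs′ fix ∷ FixD-monoL cs⊆cs′ fixes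

  ∉-⊆∷ : ∀ {cs cs′ : List Atom} {b c} → cs ⊆ c ∷ cs′ → b ≢ c → b ∉ cs′ → b ∉ cs
  ∉-⊆∷ cs⊆c∷cs′ b≢c b∉cs′ b∈cs with cs⊆c∷cs′ b∈cs
  ... | here b≡c    = b≢c b≡c
  ... | there b∈cs′ = b∉cs′ b∈cs′

  mutual
    FixD-strengthen : ∀ {c cs cs′ π t} → c # t → apply π c ≡ c → cs ⊆ c ∷ cs′ →
      FixD Υ cs π t → FixD Υ cs′ π t
    FixD-strengthen c#t πc≡c cs⊆ (fx-atom πa≡a) = fx-atom πa≡a
    FixD-strengthen {c} {π = π} (susp-# {ρ} ρc≡c) πc≡c cs⊆ (fx-susp dom) =
      fx-susp (DomCond-mono ((ρ ⁻¹ₚ) ∘ₚ (π ∘ₚ ρ)) (λ moved → ∉-⊆∷ cs⊆ λ { refl → moved c-fixed }) dom)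
      where
      c-fixed : apply ((ρ ⁻¹ₚ) ∘ₚ (π ∘ₚ ρ)) c ≡ c
      c-fixed = conj⁻¹-fixed⁺ ρ π (trans (cong (apply π) ρc≡c) (trans πc≡c (sym ρc≡c)))
    FixD-strengthen {c} (abs-# c≢a c#t) πc≡c cs⊆ (fx-abs L fix) =
      fx-abs (c ∷ L) λ c′ c′∉ →
        FixD-strengthen (#-act _ (swap-other c≢a (c′∉ ∘ here ∘ sym)) c#t) πc≡c (++⁺ˡ [ c′ ] cs⊆)
          (fix c′ (c′∉ ∘ there))
    FixD-strengthen (app-# c#ts) πc≡c cs⊆ (fx-app fixes) = fx-app (FixD-strengthenL c#ts πc≡c cs⊆ fixes)

    FixD-strengthenL : ∀ {c cs cs′ π ts} → All (c #_) ts → apply π c ≡ c → cs ⊆ c ∷ cs′ →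
      All (FixD Υ cs π) ts → All (FixD Υ cs′ π) ts
    FixD-strengthenL []             πc≡c cs⊆ []             = []
    FixD-strengthenL (c#t ∷ c#ts) πc≡c cs⊆ (fix ∷ fixes) =
      FixD-strengthen c#t πc≡c cs⊆ fix ∷ FixD-strengthenL c#ts πc≡c cs⊆ fixes

  mutual
    FixD-equivariant : ∀ {cs π t} τ → FixD Υ cs π t → FixD Υ cs (conj τ π) (act τ t)
    FixD-equivariant {π = π} τ (fx-atom {a} πa≡a) =
      fx-atom (trans (apply-conj-apply τ π a) (cong (apply τ) πa≡a))
    FixD-equivariant {π = π} τ (fx-susp {ρ} dom) =
      fx-susp (DomCond-resp (≈ₚ-sym (conj⁻¹-equivariant τ π ρ)) dom)
    FixD-equivariant {t = abs a t} τ (fx-abs L fix) =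
      fx-abs (perm-atoms τ ++ L) λ c c∉ →
        FixD-resp ≈ₚ-refl (act²-cong t (∘-swap τ refl (apply-∉-atoms τ (c∉ ∘ ∈-++⁺ˡ))))
          (FixD-equivariant τ (fix c (c∉ ∘ ∈-++⁺ʳ (perm-atoms τ))))
    FixD-equivariant τ (fx-app fixes) = fx-app (FixD-equivariantL τ fixes)

    FixD-equivariantL : ∀ {cs π ts} τ → All (FixD Υ cs π) ts → All (FixD Υ cs (conj τ π)) (actL τ ts)
    FixD-equivariantL τ []             = []
    FixD-equivariantL τ (fix ∷ fixes) = FixD-equivariant τ fix ∷ FixD-equivariantL τ fixes

  FixD-unswap : ∀ {cs π a c t} → FixD Υ cs π (act (swp a c) t) → FixD Υ cs (conj (swp a c) π) t
  FixD-unswap {a = a} {c} {t} fix =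
    FixD-resp ≈ₚ-refl (act-act-cancel t (swp-∘-swp a c [])) (FixD-equivariant (swp a c) fix)

  mutual
    FixD-∘ : ∀ {cs π ρ t} → FixD Υ cs π t → FixD Υ cs ρ t → FixD Υ cs (π ∘ₚ ρ) t
    FixD-∘ {π = π} {ρ} (fx-atom {a} πa≡a) (fx-atom ρa≡a) =
      fx-atom (trans (apply-∘ π ρ a) (trans (cong (apply π) ρa≡a) πa≡a))
    FixD-∘ {π = π} {ρ} (fx-susp {σ} domπ) (fx-susp domρ) = fx-susp dom
      where
      dom : DomCond Υ _ ((σ ⁻¹ₚ) ∘ₚ ((π ∘ₚ ρ) ∘ₚ σ)) _
      dom b moved with apply ρ (apply σ b) ≟ apply σ b
      ... | no ρ-moves  = domρ b (ρ-moves ∘ conj⁻¹-fixed⁻ σ ρ)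
      ... | yes ρ-fixes = domπ b λ π-fixes → moved (conj⁻¹-fixed⁺ σ (π ∘ₚ ρ)
              (trans (apply-∘ π ρ _) (trans (cong (apply π) ρ-fixes) (conj⁻¹-fixed⁻ σ π π-fixes))))
    FixD-∘ (fx-abs L fixπ) (fx-abs L′ fixρ) =
      fx-abs (L ++ L′) λ c c∉ → FixD-∘ (fixπ c (c∉ ∘ ∈-++⁺ˡ)) (fixρ c (c∉ ∘ ∈-++⁺ʳ L))
    FixD-∘ (fx-app fixesπ) (fx-app fixesρ) = fx-app (FixD-∘L fixesπ fixesρ)

    FixD-∘L : ∀ {cs π ρ ts} → All (FixD Υ cs π) ts → All (FixD Υ cs ρ) ts → All (FixD Υ cs (π ∘ₚ ρ)) ts
    FixD-∘L []               []               = []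
    FixD-∘L (fixπ ∷ fixesπ) (fixρ ∷ fixesρ) = FixD-∘ fixπ fixρ ∷ FixD-∘L fixesπ fixesρ

  mutual
    FixD-transposition : ∀ {cs σ b c t} → FixD Υ cs σ t → apply σ b ≢ b → c # t → c ∈ cs →
      FixD Υ cs (swp b c) t
    FixD-transposition {σ = σ} (fx-atom σa≡a) σb≢b (atom-# c≢a) c∈cs =
      fx-atom (swap-other (λ { refl → σb≢b σa≡a }) (c≢a ∘ sym))
    FixD-transposition {cs} {σ} {b} {c} (fx-susp {ρ} dom) σb≢b (susp-# ρc≡c) c∈cs = fx-susp dom′
      where
      dom′ : DomCond Υ cs ((ρ ⁻¹ₚ) ∘ₚ (swp b c ∘ₚ ρ)) _
      dom′ x moved x∉cs with swapView b c (apply ρ x)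
      ... | is-first ρx≡b =
        dom x (λ σ-fixes → σb≢b (subst (λ y → apply σ y ≡ y) ρx≡b (conj⁻¹-fixed⁻ ρ σ σ-fixes))) x∉cs
      ... | is-second _ ρx≡c =
        ⊥-elim (x∉cs (subst (_∈ cs) (apply-injective ρ (trans ρc≡c (sym ρx≡c))) c∈cs))
      ... | is-other ρx≢b ρx≢c = ⊥-elim (moved (conj⁻¹-fixed⁺ ρ (swp b c) (swap-other ρx≢b ρx≢c)))
    FixD-transposition {cs} {c = c} (fx-abs L fix) σb≢b (abs-# c≢a c#t) c∈cs =
      fx-abs (c ∷ L) λ c′ c′∉ →
        FixD-transposition (fix c′ (c′∉ ∘ there)) σb≢b
          (#-act _ (swap-other c≢a (c′∉ ∘ here ∘ sym)) c#t) (xs⊆xs++ys cs [ c′ ] c∈cs)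
    FixD-transposition (fx-app fixes) σb≢b (app-# c#ts) c∈cs =
      fx-app (FixD-transpositionL fixes σb≢b c#ts c∈cs)

    FixD-transpositionL : ∀ {cs σ b c ts} → All (FixD Υ cs σ) ts → apply σ b ≢ b →
      All (c #_) ts → c ∈ cs → All (FixD Υ cs (swp b c)) ts
    FixD-transpositionL []             σb≢b []             c∈cs = []
    FixD-transpositionL (fix ∷ fixes) σb≢b (c#t ∷ c#ts) c∈cs =
      FixD-transposition fix σb≢b c#t c∈cs ∷ FixD-transpositionL fixes σb≢b c#ts c∈cs

  mutual
    AlphaD-resp : ∀ {cs s s′ t t′} → s ≈ₜ s′ → t ≈ₜ t′ → AlphaD Υ cs s t → AlphaD Υ cs s′ t′
    AlphaD-resp atom-≈ atom-≈ α-atom = α-atom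
    AlphaD-resp (susp-≈ π≈π′) (susp-≈ ρ≈ρ′) (α-susp dom) =
      α-susp (DomCond-resp (∘-cong (⁻¹-cong ρ≈ρ′) π≈π′) dom)
    AlphaD-resp (app-≈ ss≈ss′) (app-≈ ts≈ts′) (α-app αs) = α-app (AlphaD-respL ss≈ss′ ts≈ts′ αs)
    AlphaD-resp (abs-≈ s≈s′) (abs-≈ t≈t′) (α-absEq α) = α-absEq (AlphaD-resp s≈s′ t≈t′ α)
    AlphaD-resp (abs-≈ s≈s′) (abs-≈ t≈t′) (α-ab α L fix) =
      α-ab (AlphaD-resp s≈s′ (act-cong ≈ₚ-refl t≈t′) α) L λ c c∉L → FixD-resp ≈ₚ-refl t≈t′ (fix c c∉L)

    AlphaD-respL : ∀ {cs ss ss′ ts ts′} → Pointwise _≈ₜ_ ss ss′ → Pointwise _≈ₜ_ ts ts′ →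
      Pointwise (AlphaD Υ cs) ss ts → Pointwise (AlphaD Υ cs) ss′ ts′
    AlphaD-respL []               []               []       = []
    AlphaD-respL (s≈s′ ∷ ss≈ss′) (t≈t′ ∷ ts≈ts′) (α ∷ αs) =
      AlphaD-resp s≈s′ t≈t′ α ∷ AlphaD-respL ss≈ss′ ts≈ts′ αs

  mutual
    AlphaD-equivariant : ∀ {cs s t} τ → AlphaD Υ cs s t → AlphaD Υ cs (act τ s) (act τ t)
    AlphaD-equivariant τ α-atom = α-atom
    AlphaD-equivariant τ (α-susp {π} {ρ} dom) =
      α-susp (DomCond-resp (≈ₚ-sym (⁻¹∘-equivariant τ π ρ)) dom)
    AlphaD-equivariant τ (α-app αs) = α-app (AlphaD-equivariantL τ αs)
    AlphaD-equivariant τ (α-absEq α) = α-absEq (AlphaD-equivariant τ α)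
    AlphaD-equivariant τ (α-ab {a} {b} {t = t} α L fix) =
      α-ab (AlphaD-resp (≈ₜ-refl _) (act²-cong t (∘-swap τ refl refl)) (AlphaD-equivariant τ α))
        (perm-atoms τ ++ L) λ c c∉ →
          FixD-resp (conj-swp τ refl (apply-∉-atoms τ (c∉ ∘ ∈-++⁺ˡ))) (≈ₜ-refl _)
            (FixD-equivariant τ (fix c (c∉ ∘ ∈-++⁺ʳ (perm-atoms τ))))

    AlphaD-equivariantL : ∀ {cs ss ts} τ → Pointwise (AlphaD Υ cs) ss ts →
      Pointwise (AlphaD Υ cs) (actL τ ss) (actL τ ts)
    AlphaD-equivariantL τ []       = []
    AlphaD-equivariantL τ (α ∷ αs) = AlphaD-equivariant τ α ∷ AlphaD-equivariantL τ αs

-- Abstractions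

record FreshFor (L : List Atom) (π : Perm) (a : Atom) (t : Term) (c : Atom) : Set where
  field
    c∉L  : c ∉ L
    πc≡c : apply π c ≡ c
    c#t  : c # t
    c≢a  : c ≢ a

avoid : List Atom → Perm → Atom → Term → List Atom
avoid L π a t = a ∷ L ++ perm-atoms π ++ term-atoms t

freshFor : ∀ L π a t {c} → c ∉ avoid L π a t → FreshFor L π a t c
freshFor L π a t c∉ = record
  { c∉L  = c∉′ ∘ ∈-++⁺ˡ
  ; πc≡c = apply-∉-atoms π (c∉′ ∘ ∈-++⁺ʳ L ∘ ∈-++⁺ˡ)
  ; c#t  = ∉-atoms⇒# t (c∉′ ∘ ∈-++⁺ʳ L ∘ ∈-++⁺ʳ (perm-atoms π))
  ; c≢a  = c∉ ∘ here
  }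
  where c∉′ = c∉ ∘ there

∷ʳ⊆∷ : ∀ (cs : List Atom) c → cs ++ [ c ] ⊆ c ∷ cs
∷ʳ⊆∷ cs c = ∈-resp-↭ (↭-sym (∷↭∷ʳ c cs))

module _ {Υ : Ctx} {cs : List Atom} where

  FixD-abs-fixed⁺ : ∀ {π a t} → apply π a ≡ a → FixD Υ cs π t → FixD Υ cs π (abs a t)
  FixD-abs-fixed⁺ {π} {a} πa≡a fix = fx-abs (perm-atoms π) λ c c∉ →
    FixD-resp (conj-swp-fixed πa≡a (apply-∉-atoms π c∉)) (≈ₜ-refl _)
      (FixD-equivariant (swp a c) (FixD-mono (xs⊆xs++ys cs [ c ]) fix))

  FixD-abs-fixed⁻ : ∀ {π a t} → apply π a ≡ a → FixD Υ cs π (abs a t) → FixD Υ cs π t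
  FixD-abs-fixed⁻ {π} {a} {t} πa≡a (fx-abs L fix) =
    FixD-strengthen c#t πc≡c (∷ʳ⊆∷ cs _)
      (FixD-resp (conj-swp-fixed πa≡a πc≡c) (≈ₜ-refl t) (FixD-unswap (fix _ c∉L)))
    where open FreshFor (freshFor L π a t (fresh-∉ (avoid L π a t)))

  FixD⇒AlphaD-abs : ∀ {π a t} → (∀ ρ → FixD Υ cs ρ t → AlphaD Υ cs (act ρ t) t) →
    FixD Υ cs π (abs a t) → AlphaD Υ cs (act π (abs a t)) (abs a t)
  FixD⇒AlphaD-abs {π} {a} {t} ih fix-abs@(fx-abs L fix) with apply π a ≟ a
  ... | yes πa≡a = subst (λ b → AlphaD Υ cs (abs b (act π t)) (abs a t)) (sym πa≡a)
                     (α-absEq (ih π (FixD-abs-fixed⁻ πa≡a fix-abs)))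
  ... | no πa≢a = α-ab α-body (avoid L π a t) fix-bc
    where
    b = apply π a
    fix-bc : ∀ c → c ∉ avoid L π a t → FixD Υ (cs ++ [ c ]) (swp b c) t
    fix-bc c c∉ = FixD-transposition (FixD-unswap (fix c c∉L))
                    (conj-swp-moves {π = π} πa≢a πc≡c c≢a) c#t (∈-++⁺ʳ cs (here refl))
      where open FreshFor (freshFor L π a t c∉)
    fix-baπ : FixD Υ cs (swp b a ∘ₚ π) t
    fix-baπ = FixD-strengthen c#t baπc≡c (∷ʳ⊆∷ cs c)
      (FixD-resp (swp-∘-conj-swp πa≢a πc≡c c≢a) (≈ₜ-refl t)
        (FixD-∘ (fix-bc c c∉) (FixD-unswap (fix c c∉L))))
      where
      c = fresh (avoid L π a t)
      c∉ = fresh-∉ (avoid L π a t)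
      open FreshFor (freshFor L π a t c∉)
      baπc≡c : swapAtom (b , a) (apply π c) ≡ c
      baπc≡c = trans (cong (swapAtom (b , a)) πc≡c)
                 (swap-other (λ c≡b → c≢a (apply-injective π (trans πc≡c c≡b))) c≢a)
    α-body : AlphaD Υ cs (act π t) (act (swp b a) t)
    α-body = AlphaD-resp (act-act t (swp-∘-swp b a π)) (≈ₜ-refl _)
               (AlphaD-equivariant (swp b a) (ih _ fix-baπ))

  FixD-abs-via-swaps : ∀ {π a t} L → FixD Υ cs (swp (apply π a) a ∘ₚ π) t →
    (∀ c → c ∉ L → FixD Υ (cs ++ [ c ]) (swp (apply π a) c) t) → FixD Υ cs π (abs a t)
  FixD-abs-via-swaps {π} {a} {t} L fix-baπ fix-bc with apply π a ≟ a
  ... | yes πa≡a = FixD-abs-fixed⁺ πa≡a (FixD-resp (mk≈ₚ ba≈id) (≈ₜ-refl t) fix-baπ)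
    where
    ba≈id : ∀ x → swapAtom (apply π a , a) (apply π x) ≡ apply π x
    ba≈id x = subst (λ b → swapAtom (b , a) (apply π x) ≡ apply π x) (sym πa≡a) (swap-self a _)
  ... | no πa≢a = fx-abs (avoid L π a t) λ c c∉ → let open FreshFor (freshFor L π a t c∉) in
    FixD-resp (conj-swp-involutive a c π) (≈ₜ-refl _)
      (FixD-equivariant (swp a c)
        (FixD-resp (≈ₚ-sym (conj-swp-moved πa≢a πc≡c c≢a)) (≈ₜ-refl t)
          (FixD-∘ (fix-bc c c∉L) (FixD-mono (xs⊆xs++ys cs [ c ]) fix-baπ))))

  AlphaD⇒FixD-abs : ∀ {π a t} → (∀ ρ → AlphaD Υ cs (act ρ t) t → FixD Υ cs ρ t) →
    ∀ {x u} → x ≡ apply π a → u ≡ act π t → AlphaD Υ cs (abs x u) (abs a t) → FixD Υ cs π (abs a t)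
  AlphaD⇒FixD-abs ih x≡πa refl (α-absEq α) = FixD-abs-fixed⁺ (sym x≡πa) (ih _ α)
  AlphaD⇒FixD-abs {π} {a} {t} ih refl refl (α-ab α L fix-bc) = FixD-abs-via-swaps L (ih _ α′) fix-bc
    where
    b = apply π a
    α′ : AlphaD Υ cs (act (swp b a ∘ₚ π) t) t
    α′ = AlphaD-resp (act-act t ≈ₚ-refl) (act-act-cancel t (swp-∘-swp b a []))
           (AlphaD-equivariant (swp b a) α)

mutual
  FixD⇒AlphaD : ∀ Υ cs π t → FixD Υ cs π t → AlphaD Υ cs (act π t) t
  FixD⇒AlphaD Υ cs π (atom a)   (fx-atom πa≡a) =
    subst (λ b → AlphaD Υ cs (atom b) (atom a)) (sym πa≡a) α-atom
  FixD⇒AlphaD Υ cs π (susp ρ X) (fx-susp dom)  = α-susp dom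
  FixD⇒AlphaD Υ cs π (abs a t)  fix            = FixD⇒AlphaD-abs (λ ρ → FixD⇒AlphaD Υ cs ρ t) fix
  FixD⇒AlphaD Υ cs π (app f ts) (fx-app fixes) = α-app (FixD⇒AlphaDL Υ cs π ts fixes)

  FixD⇒AlphaDL : ∀ Υ cs π ts → All (FixD Υ cs π) ts → Pointwise (AlphaD Υ cs) (actL π ts) ts
  FixD⇒AlphaDL Υ cs π []       []             = []
  FixD⇒AlphaDL Υ cs π (t ∷ ts) (fix ∷ fixes) = FixD⇒AlphaD Υ cs π t fix ∷ FixD⇒AlphaDL Υ cs π ts fixes

α-atom-inv : ∀ {Υ cs a b} → AlphaD Υ cs (atom a) (atom b) → a ≡ b
α-atom-inv α-atom = refl

mutual
  AlphaD⇒FixD : ∀ Υ cs π t → AlphaD Υ cs (act π t) t → FixD Υ cs π t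
  AlphaD⇒FixD Υ cs π (atom a)   α          = fx-atom (α-atom-inv α)
  AlphaD⇒FixD Υ cs π (susp ρ X) (α-susp dom) = fx-susp dom
  AlphaD⇒FixD Υ cs π (abs a t)  α          = AlphaD⇒FixD-abs (λ ρ → AlphaD⇒FixD Υ cs ρ t) refl refl α
  AlphaD⇒FixD Υ cs π (app f ts) (α-app αs) = fx-app (AlphaD⇒FixDL Υ cs π ts αs)

  AlphaD⇒FixDL : ∀ Υ cs π ts → Pointwise (AlphaD Υ cs) (actL π ts) ts → All (FixD Υ cs π) ts
  AlphaD⇒FixDL Υ cs π []       []       = []
  AlphaD⇒FixDL Υ cs π (t ∷ ts) (α ∷ αs) = AlphaD⇒FixD Υ cs π t α ∷ AlphaD⇒FixDL Υ cs π ts αs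

theorem5p3 : (A c₀ cs : List Atom) (Υ : Ctx) → StrongCtx A c₀ Υ → Unique cs → c₀ ⊆ cs
    → (π : Perm) (t : Term) → FixD Υ cs π t ⇔ AlphaD Υ cs (act π t) t
theorem5p3 A c₀ cs Υ _ _ _ π t = mk⇔ (FixD⇒AlphaD Υ cs π t) (AlphaD⇒FixD Υ cs π t)
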